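{- Let $k$ be a nonnegative integer and let $G$ be a connected $(k+2)$-regular graph with $G\neq K_{k+2,k+2}$. Then $Z_k(G)\leq \frac{3|G|}{k+3}$.
   Context: Graphs are finite, simple and undirected; $|G|$ is the number of vertices. For a graph $G=(V,E)$, nonnegative integer $k$ and $T\subseteq V$, $\mathscr F^0_{G,k}(T)=T$, $\mathscr F^{i+1}_{G,k}(T)=\mathscr F^i_{G,k}(T)\cup\bigcup\{N(v): v\in \mathscr F^i_{G,k}(T),\ 1\le |N(v)\setminus \mathscr F^i_{G,k}(T)|\le k\}$; $T$ is a $k$-forcing set if $\mathscr F^t_{G,k}(T)=V$ for some $t$, and $Z_k(G)$ is the minimum size of a $k$-forcing set. -}

module Defs where

open import Data.Nat using (ℕ; zero; suc; _+_; _*_; _≤_; _<ᵇ_; _≤?_)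
open import Data.Bool using (Bool; true; false; _∧_; _∨_; _xor_; not)
open import Data.Fin using (Fin; toℕ)
open import Data.Fin.Subset using (Subset; ∣_∣; _─_; ⊤)
open import Data.Vec using (tabulate; lookup)
open import Data.Bool using (T)
open import Data.Fin.Properties using (any?)
open import Relation.Nullary.Decidable using (⌊_⌋)
open import Relation.Binary.PropositionalEquality using (_≡_)
open import Data.Product using (Σ; ∃; _×_)
open import Function.Bundles using (_↔_; Inverse)
open import Relation.Nullary using (¬_)

record Graph (n : ℕ) : Set where
  field
    adj    : Fin n → Fin n → Bool
    sym    : ∀ u v → adj u v ≡ adj v u
    irrefl : ∀ v → adj v v ≡ false
open Graph public

N : ∀ {n} → Graph n → Fin n → Subset n
N G v = tabulate (adj G v)

degree : ∀ {n} → Graph n → Fin n → ℕ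
degree G v = ∣ N G v ∣

Regular : ∀ {n} → ℕ → Graph n → Set
Regular r G = ∀ v → degree G v ≡ r

data Walk {n} (G : Graph n) : Fin n → Fin n → Set where
  here : ∀ {v} → Walk G v v
  step : ∀ {u v w} → adj G u v ≡ true → Walk G v w → Walk G u w

Connected : ∀ {n} → Graph n → Set
Connected G = ∀ u v → Walk G u v

Kbip : (a b : ℕ) → Graph (a + b)
Kbip a b = record
  { adj = λ i j → (toℕ i <ᵇ a) xor (toℕ j <ᵇ a)
  ; sym = λ i j → xor-comm (toℕ i <ᵇ a) (toℕ j <ᵇ a)
  ; irrefl = λ i → xor-self (toℕ i <ᵇ a)
  }
  where
  xor-comm : ∀ x y → (x xor y) ≡ (y xor x)
  xor-comm false false = _≡_.refl
  xor-comm false true  = _≡_.refl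
  xor-comm true  false = _≡_.refl
  xor-comm true  true  = _≡_.refl
  xor-self : ∀ x → (x xor x) ≡ false
  xor-self false = _≡_.refl
  xor-self true  = _≡_.refl

Iso : ∀ {n m} → Graph n → Graph m → Set
Iso {n} {m} G H = Σ (Fin n ↔ Fin m) λ f →
  ∀ u v → adj G u v ≡ adj H (Inverse.to f u) (Inverse.to f v)

active : ∀ {n} → Graph n → ℕ → Subset n → Fin n → Bool
active G k F v = lookup F v ∧ ⌊ 1 ≤? ∣ N G v ─ F ∣ ⌋ ∧ ⌊ ∣ N G v ─ F ∣ ≤? k ⌋

forceStep : ∀ {n} → Graph n → ℕ → Subset n → Subset n
forceStep G k F = tabulate λ u →
  lookup F u ∨ ⌊ any? (λ v → T? (active G k F v ∧ adj G v u)) ⌋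
  where
  open import Data.Bool.Properties using () renaming (T? to T?)

forceIter : ∀ {n} → Graph n → ℕ → ℕ → Subset n → Subset n
forceIter G k zero    T = T
forceIter G k (suc t) T = forceStep G k (forceIter G k t T)

IsForcingSet : ∀ {n} → Graph n → ℕ → Subset n → Set
IsForcingSet G k T = ∃ λ t → forceIter G k t T ≡ ⊤

-- Grow a set C of vertices that the chosen set T is guaranteed to force, keeping
-- (k+3)|T| ≤ 3|C|. If some u ∈ C has m ≥ 1 neighbours outside C, put m ∸ k of them
-- into T, after which u forces all of N(u): T gains m ∸ k ≤ 2 vertices, C gains m,
-- and (m ∸ k)(k+3) ≤ 3m. Otherwise C is closed under neighbourhoods, and a fresh
-- vertex w together with two of its neighbours goes into T; then w forces N(w), so
-- three new vertices of T pay for the k+3 new vertices {w} ∪ N(w) of C.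
module Submission where

open import Defs
open import Data.Nat using (ℕ; _+_; _*_; _≤_)
open import Data.Fin.Subset using (Subset; ∣_∣)
open import Data.Product using (Σ; _×_)
open import Relation.Nullary using (¬_)

open import Data.Nat using (zero; suc; z≤n; s≤s; _∸_; _<_; _≤?_)
open import Data.Nat.Properties
  using (≤-refl; ≤-reflexive; ≤-trans; ≤-antisym; ≤-pred; +-comm; +-suc; +-monoʳ-≤; +-mono-≤;
         *-monoˡ-≤; *-monoʳ-≤; *-distribˡ-+; *-distribʳ-+; *-comm; m≤n+m; m≤m+n; m≤n+m∸n; m≤n⇒m∸n≡0;
         m+[n∸m]≡n; m+n∸m≡n; ∸-monoˡ-≤; ≰⇒≥; module ≤-Reasoning)
open import Data.Bool using (Bool; true; false; _∧_)
import Data.Bool as Bool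
open import Data.Bool.Properties using (T-≡; T-∧; T-∨; T?)
open import Data.Fin using (Fin)
open import Data.Fin.Properties using (any?)
open import Data.Fin.Subset using (_∈_; _∉_; _⊆_; _∪_; _─_; ⁅_⁆; ⊤; ⊥; Nonempty)
open import Data.Fin.Subset.Properties
  using (_∈?_; nonempty?; ∉⊥; x∈⁅x⁆; x∈⁅y⁆⇒x≡y; ∣⁅x⁆∣≡1; ∣⊥∣≡0; ∣p∣≤n; ∣p∣≡n⇒p≡⊤;
         p⊆q⇒∣p∣≤∣q∣; ∣p─q∣≤∣p∣; p─q─r≡p─q∪r; x∈p∧x∉q⇒x∈p─q; p─q⊆p;
         x∈p⇒∣p-x∣<∣p∣; x∈p∪q⁻; x∈p∪q⁺; p⊆p∪q; q⊆p∪q; Empty-unique; ⊆-antisym; ⊆⊤)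
open import Data.Vec using ([]; _∷_; here; there; lookup; tabulate)
open import Data.Vec.Properties using (lookup∘tabulate; []=⇒lookup; lookup⇒[]=)
open import Data.Product using (_,_; proj₁; proj₂; ∃-syntax)
open import Data.Sum using (_⊎_; inj₁; inj₂; map₁)
open import Data.Empty using (⊥-elim)
open import Function.Bundles using (Equivalence)
open import Relation.Nullary using (yes; no; ¬?; _×-dec_)
open import Relation.Nullary.Decidable using (fromWitness; decidable-stable)
open import Relation.Binary.PropositionalEquality
  using (_≡_; refl; trans; cong; cong₂; subst; module ≡-Reasoning)
  renaming (sym to ≡-sym)

∣p∪q∣≡∣p∣+∣q─p∣ : ∀ {m} (p q : Subset m) → ∣ p ∪ q ∣ ≡ ∣ p ∣ + ∣ q ─ p ∣
∣p∪q∣≡∣p∣+∣q─p∣ []          []          = refl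
∣p∪q∣≡∣p∣+∣q─p∣ (true ∷ p)  (_ ∷ q)     = cong suc (∣p∪q∣≡∣p∣+∣q─p∣ p q)
∣p∪q∣≡∣p∣+∣q─p∣ (false ∷ p) (true ∷ q)  =
  trans (cong suc (∣p∪q∣≡∣p∣+∣q─p∣ p q)) (≡-sym (+-suc ∣ p ∣ ∣ q ─ p ∣))
∣p∪q∣≡∣p∣+∣q─p∣ (false ∷ p) (false ∷ q) = ∣p∪q∣≡∣p∣+∣q─p∣ p q

x∈p─q⇒x∉q : ∀ {m} (p q : Subset m) {x} → x ∈ p ─ q → x ∉ q
x∈p─q⇒x∉q (true ∷ p) (false ∷ q) here         ()
x∈p─q⇒x∉q (_ ∷ p)    (_ ∷ q)     (there x∈p─q) (there x∈q) = x∈p─q⇒x∉q p q x∈p─q x∈q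

x∈p⇒0<∣p∣ : ∀ {m} {p : Subset m} {x} → x ∈ p → 0 < ∣ p ∣
x∈p⇒0<∣p∣ x∈p = ≤-trans (s≤s z≤n) (x∈p⇒∣p-x∣<∣p∣ x∈p)

∣p∪⁅x⁆∣≤1+∣p∣ : ∀ {m} (p : Subset m) x → ∣ p ∪ ⁅ x ⁆ ∣ ≤ 1 + ∣ p ∣
∣p∪⁅x⁆∣≤1+∣p∣ p x = begin
  ∣ p ∪ ⁅ x ⁆ ∣         ≡⟨ ∣p∪q∣≡∣p∣+∣q─p∣ p ⁅ x ⁆ ⟩
  ∣ p ∣ + ∣ ⁅ x ⁆ ─ p ∣ ≤⟨ +-monoʳ-≤ ∣ p ∣ (≤-trans (∣p─q∣≤∣p∣ ⁅ x ⁆ p) (≤-reflexive (∣⁅x⁆∣≡1 x))) ⟩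
  ∣ p ∣ + 1             ≡⟨ +-comm ∣ p ∣ 1 ⟩
  1 + ∣ p ∣             ∎
  where open ≤-Reasoning

x∉p⇒∣p∪⁅x⁆∣≡1+∣p∣ : ∀ {m} {p : Subset m} {x} → x ∉ p → ∣ p ∪ ⁅ x ⁆ ∣ ≡ 1 + ∣ p ∣
x∉p⇒∣p∪⁅x⁆∣≡1+∣p∣ {p = p} {x} x∉p = ≤-antisym (∣p∪⁅x⁆∣≤1+∣p∣ p x) (begin
  1 + ∣ p ∣             ≡⟨ +-comm 1 ∣ p ∣ ⟩
  ∣ p ∣ + 1             ≤⟨ +-monoʳ-≤ ∣ p ∣ (x∈p⇒0<∣p∣ (x∈p∧x∉q⇒x∈p─q (x∈⁅x⁆ x) x∉p)) ⟩
  ∣ p ∣ + ∣ ⁅ x ⁆ ─ p ∣ ≡⟨ ∣p∪q∣≡∣p∣+∣q─p∣ p ⁅ x ⁆ ⟨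
  ∣ p ∪ ⁅ x ⁆ ∣         ∎)
  where open ≤-Reasoning

T⇒∈tabulate : ∀ {m} {f : Fin m → Bool} {x} → Bool.T (f x) → x ∈ tabulate f
T⇒∈tabulate {f = f} {x} fx =
  lookup⇒[]= x (tabulate f) (trans (lookup∘tabulate f x) (Equivalence.to T-≡ fx))

∈tabulate⇒≡true : ∀ {m} {f : Fin m → Bool} {x} → x ∈ tabulate f → f x ≡ true
∈tabulate⇒≡true {f = f} {x} x∈ = trans (≡-sym (lookup∘tabulate f x)) ([]=⇒lookup x∈)

∈⇒T : ∀ {m} {p : Subset m} {x} → x ∈ p → Bool.T (lookup p x)
∈⇒T x∈p = Equivalence.from T-≡ ([]=⇒lookup x∈p)

[m∸k]*[k+3]≤3*m : ∀ k m → m ≤ k + 3 → (m ∸ k) * (k + 3) ≤ 3 * m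
[m∸k]*[k+3]≤3*m k m m≤k+3 with m ≤? k
... | yes m≤k rewrite m≤n⇒m∸n≡0 m≤k = z≤n
... | no m≰k = begin
  (m ∸ k) * (k + 3)       ≡⟨ *-distribˡ-+ (m ∸ k) k 3 ⟩
  (m ∸ k) * k + (m ∸ k) * 3 ≤⟨ +-mono-≤ (*-monoˡ-≤ k m∸k≤3) (≤-reflexive (*-comm (m ∸ k) 3)) ⟩
  3 * k + 3 * (m ∸ k)     ≡⟨ *-distribˡ-+ 3 k (m ∸ k) ⟨
  3 * (k + (m ∸ k))       ≡⟨ cong (3 *_) (m+[n∸m]≡n (≰⇒≥ m≰k)) ⟩
  3 * m                   ∎
  where
  open ≤-Reasoning
  m∸k≤3 : m ∸ k ≤ 3
  m∸k≤3 = ≤-trans (∸-monoˡ-≤ k m≤k+3) (≤-reflexive (m+n∸m≡n k 3))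

budget-step : ∀ r {t t′ c c′ a b} →
  t * r ≤ 3 * c → t′ ≤ a + t → c + b ≤ c′ → a * r ≤ 3 * b → t′ * r ≤ 3 * c′
budget-step r {t} {t′} {c} {c′} {a} {b} t≤c t′≤a+t c+b≤c′ a≤b = begin
  t′ * r        ≤⟨ *-monoˡ-≤ r t′≤a+t ⟩
  (a + t) * r   ≡⟨ *-distribʳ-+ r a t ⟩
  a * r + t * r ≤⟨ +-mono-≤ a≤b t≤c ⟩
  3 * b + 3 * c ≡⟨ *-distribˡ-+ 3 b c ⟨
  3 * (b + c)   ≡⟨ cong (3 *_) (+-comm b c) ⟩
  3 * (c + b)   ≤⟨ *-monoʳ-≤ 3 c+b≤c′ ⟩
  3 * c′        ∎
  where open ≤-Reasoning

module Forcing {n} (G : Graph n) (k : ℕ) where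

  adj⇒∈N : ∀ {u x} → adj G u x ≡ true → x ∈ N G u
  adj⇒∈N a = T⇒∈tabulate (Equivalence.from T-≡ a)

  ∈N-sym : ∀ {u x} → x ∈ N G u → u ∈ N G x
  ∈N-sym {u} {x} x∈ = adj⇒∈N (trans (Graph.sym G x u) (∈tabulate⇒≡true x∈))

  ∉N-self : ∀ u → u ∉ N G u
  ∉N-self u u∈ with trans (≡-sym (irrefl G u)) (∈tabulate⇒≡true u∈)
  ... | ()

  F⊆forceStep : ∀ {F} → F ⊆ forceStep G k F
  F⊆forceStep x∈F = T⇒∈tabulate (Equivalence.from T-∨ (inj₁ (∈⇒T x∈F)))

  ∈N⇒∈forceStep : ∀ {F v x} → v ∈ F → x ∈ N G v → ∣ N G v ─ F ∣ ≤ k → x ∈ forceStep G k F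
  ∈N⇒∈forceStep {F} {v} {x} v∈F x∈N ≤k with x ∈? F
  ... | yes x∈F = F⊆forceStep x∈F
  ... | no x∉F = T⇒∈tabulate (Equivalence.from T-∨ (inj₂
    (fromWitness {a? = any? (λ w → T? (active G k F w ∧ adj G w x))} (v , fires))))
    where
    fires : Bool.T (active G k F v ∧ adj G v x)
    fires = Equivalence.from T-∧
      ( Equivalence.from T-∧
          ( ∈⇒T v∈F
          , Equivalence.from T-∧
              ( fromWitness {a? = 1 ≤? ∣ N G v ─ F ∣} (x∈p⇒0<∣p∣ (x∈p∧x∉q⇒x∈p─q x∈N x∉F))
              , fromWitness {a? = ∣ N G v ─ F ∣ ≤? k} ≤k))
      , Equivalence.from T-≡ (∈tabulate⇒≡true x∈N))

  F⊆forceIter : ∀ t {F} → F ⊆ forceIter G k t F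
  F⊆forceIter zero    x∈F = x∈F
  F⊆forceIter (suc t) x∈F = F⊆forceStep (F⊆forceIter t x∈F)

  -- Quantifying over all supersets of T makes enlarging T free, without having to
  -- show that forcing is monotone.
  record Forces (t : ℕ) (T C : Subset n) : Set where
    constructor mkForces
    field
      forced : ∀ {T′} → T ⊆ T′ → C ⊆ forceIter G k t T′
  open Forces

  Forces-⊥ : ∀ {T} → Forces 0 T ⊥
  Forces-⊥ = mkForces λ _ x∈⊥ → ⊥-elim (∉⊥ x∈⊥)

  Forces-⊆ : ∀ {t T C C′} → C′ ⊆ C → Forces t T C → Forces t T C′
  Forces-⊆ C′⊆C F = mkForces λ T⊆T′ x∈C′ → forced F T⊆T′ (C′⊆C x∈C′)

  Forces-∪ : ∀ {t T C} A → Forces t T C → Forces t (T ∪ A) (C ∪ A)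
  Forces-∪ {t} {T} {C} A F = mkForces forced-∪
    where
    forced-∪ : ∀ {T′} → T ∪ A ⊆ T′ → C ∪ A ⊆ forceIter G k t T′
    forced-∪ T∪A⊆T′ x∈C∪A with x∈p∪q⁻ C A x∈C∪A
    ... | inj₁ x∈C = forced F (λ y∈T → T∪A⊆T′ (p⊆p∪q A y∈T)) x∈C
    ... | inj₂ x∈A = F⊆forceIter t (T∪A⊆T′ (q⊆p∪q T A x∈A))

  Forces-N : ∀ {t T C u} → Forces t T C → u ∈ C → ∣ N G u ─ C ∣ ≤ k →
             Forces (suc t) T (C ∪ N G u)
  Forces-N {t} {T} {C} {u} F u∈C ≤k = mkForces forced-N
    where
    shrink : ∀ {F} → C ⊆ F → N G u ─ F ⊆ N G u ─ C
    shrink C⊆F y∈ = x∈p∧x∉q⇒x∈p─q (p─q⊆p _ _ y∈) (λ y∈C → x∈p─q⇒x∉q _ _ y∈ (C⊆F y∈C))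
    forced-N : ∀ {T′} → T ⊆ T′ → C ∪ N G u ⊆ forceIter G k (suc t) T′
    forced-N T⊆T′ x∈C∪N with x∈p∪q⁻ C (N G u) x∈C∪N
    ... | inj₁ x∈C = F⊆forceStep (forced F T⊆T′ x∈C)
    ... | inj₂ x∈N = ∈N⇒∈forceStep (forced F T⊆T′ u∈C) x∈N
                       (≤-trans (p⊆q⇒∣p∣≤∣q∣ (shrink (forced F T⊆T′))) ≤k)

  Forces-⊤ : ∀ {t T} → Forces t T ⊤ → IsForcingSet G k T
  Forces-⊤ {t} F = t , ⊆-antisym ⊆⊤ (forced F λ x∈T → x∈T)

  Forces-N-after-adding : ∀ j {t T C u} → Forces t T C → u ∈ C → ∣ N G u ─ C ∣ ≤ j + k →
    ∃[ T′ ] ∣ T′ ∣ ≤ j + ∣ T ∣ × Forces (suc t) T′ (C ∪ N G u)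
  Forces-N-after-adding zero {T = T} forces u∈C ≤k = T , ≤-refl , Forces-N forces u∈C ≤k
  Forces-N-after-adding (suc j) {t} {T} {C} {u} forces u∈C ≤j+k with nonempty? (N G u ─ C)
  ... | no empty = T , m≤n+m ∣ T ∣ (suc j) , Forces-N forces u∈C none-outside
    where
    none-outside : ∣ N G u ─ C ∣ ≤ k
    none-outside rewrite Empty-unique empty | ∣⊥∣≡0 n = z≤n
  ... | yes (w , w∈N─C)
    with Forces-N-after-adding j (Forces-∪ ⁅ w ⁆ forces) (p⊆p∪q ⁅ w ⁆ u∈C) one-fewer
    where
    one-fewer : ∣ N G u ─ (C ∪ ⁅ w ⁆) ∣ ≤ j + k
    one-fewer rewrite ≡-sym (p─q─r≡p─q∪r (N G u) C ⁅ w ⁆) =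
      ≤-pred (≤-trans (x∈p⇒∣p-x∣<∣p∣ w∈N─C) ≤j+k)
  ...   | T′ , T′-size , forces′ = T′ , T′-bound , Forces-⊆ C∪N⊆ forces′
    where
    T′-bound : ∣ T′ ∣ ≤ suc j + ∣ T ∣
    T′-bound = ≤-trans T′-size
      (≤-trans (+-monoʳ-≤ j (∣p∪⁅x⁆∣≤1+∣p∣ T w)) (≤-reflexive (+-suc j ∣ T ∣)))
    C∪N⊆ : C ∪ N G u ⊆ (C ∪ ⁅ w ⁆) ∪ N G u
    C∪N⊆ x∈ = x∈p∪q⁺ (map₁ (p⊆p∪q ⁅ w ⁆) (x∈p∪q⁻ C (N G u) x∈))

module Greedy {n} (G : Graph n) (k : ℕ) (regular : Regular (k + 2) G) where
  open Forcing G k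

  record Certificate : Set where
    constructor certificate
    field
      {steps} : ℕ
      T C     : Subset n
      forces  : Forces steps T C
      budget  : ∣ T ∣ * (k + 3) ≤ 3 * ∣ C ∣
  open Certificate

  Extension : Certificate → Set
  Extension c = ∃[ c′ ] ∣ C c ∣ < ∣ C c′ ∣

  extend : (c : Certificate) (a b : ℕ) {t : ℕ} {C′ : Subset n} →
           (∃[ T′ ] ∣ T′ ∣ ≤ a + ∣ T c ∣ × Forces t T′ C′) →
           ∣ C c ∣ + b ≤ ∣ C′ ∣ → a * (k + 3) ≤ 3 * b → 0 < b → Extension c
  extend c a b {C′ = C′} (T′ , T′-size , F′) C′-size a≤b 0<b =
    certificate T′ C′ F′
      (budget-step (k + 3) {t = ∣ T c ∣} {c = ∣ C c ∣} (budget c) T′-size C′-size a≤b) ,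
    ≤-trans (≤-reflexive (+-comm 1 ∣ C c ∣)) (≤-trans (+-monoʳ-≤ ∣ C c ∣ 0<b) C′-size)

  ∣N─C∣≤k+2 : ∀ u C → ∣ N G u ─ C ∣ ≤ k + 2
  ∣N─C∣≤k+2 u C = ≤-trans (∣p─q∣≤∣p∣ (N G u) C) (≤-reflexive (regular u))

  extend-at-boundary : (c : Certificate) {u : Fin n} → u ∈ C c → Nonempty (N G u ─ C c) →
                       Extension c
  extend-at-boundary c@(certificate T C F _) {u} u∈C (_ , x∈N─C) =
    extend c (m ∸ k) m
      (Forces-N-after-adding (m ∸ k) F u∈C (≤-trans (m≤n+m∸n m k) (≤-reflexive (+-comm k (m ∸ k)))))
      (≤-reflexive (≡-sym (∣p∪q∣≡∣p∣+∣q─p∣ C (N G u))))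
      ([m∸k]*[k+3]≤3*m k m (≤-trans (∣N─C∣≤k+2 u C) (+-monoʳ-≤ k (s≤s (s≤s z≤n)))))
      (x∈p⇒0<∣p∣ x∈N─C)
    where m = ∣ N G u ─ C ∣

  extend-outside-closed : (c : Certificate) {w : Fin n} → w ∉ C c →
    (∀ {u x} → u ∈ C c → x ∈ N G u → x ∈ C c) → Extension c
  extend-outside-closed c@(certificate T C F _) {w} w∉C closed =
    extend c 3 (k + 3) (add-w-and-force (Forces-∪ ⁅ w ⁆ F)) (≤-reflexive C′-size) ≤-refl
      (≤-trans (s≤s z≤n) (m≤n+m 3 k))
    where
    C₁ = C ∪ ⁅ w ⁆
    w∈C₁ : w ∈ C₁
    w∈C₁ = q⊆p∪q C ⁅ w ⁆ (x∈⁅x⁆ w)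
    add-w-and-force : ∀ {t} → Forces t (T ∪ ⁅ w ⁆) C₁ →
                      ∃[ T′ ] ∣ T′ ∣ ≤ 3 + ∣ T ∣ × Forces (suc t) T′ (C₁ ∪ N G w)
    add-w-and-force F₁ with Forces-N-after-adding 2 F₁ w∈C₁
                              (≤-trans (∣N─C∣≤k+2 w C₁) (≤-reflexive (+-comm k 2)))
    ... | T′ , T′-size , F′ = T′ , ≤-trans T′-size (+-monoʳ-≤ 2 (∣p∪⁅x⁆∣≤1+∣p∣ T w)) , F′
    N⊆N─C₁ : N G w ⊆ N G w ─ C₁
    N⊆N─C₁ {x} x∈N = x∈p∧x∉q⇒x∈p─q x∈N λ x∈C₁ → case-C₁ (x∈p∪q⁻ C ⁅ w ⁆ x∈C₁)
      where
      case-C₁ : x ∈ C ⊎ x ∈ ⁅ w ⁆ → Data.Empty.⊥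
      case-C₁ (inj₁ x∈C) = w∉C (closed x∈C (∈N-sym x∈N))
      case-C₁ (inj₂ x∈w) = ∉N-self w (subst (_∈ N G w) (x∈⁅y⁆⇒x≡y w x∈w) x∈N)
    ∣N─C₁∣≡k+2 : ∣ N G w ─ C₁ ∣ ≡ k + 2
    ∣N─C₁∣≡k+2 = ≤-antisym (∣N─C∣≤k+2 w C₁)
      (≤-trans (≤-reflexive (≡-sym (regular w))) (p⊆q⇒∣p∣≤∣q∣ N⊆N─C₁))
    C′-size : ∣ C ∣ + (k + 3) ≡ ∣ C₁ ∪ N G w ∣
    C′-size = ≡-sym (begin
      ∣ C₁ ∪ N G w ∣          ≡⟨ ∣p∪q∣≡∣p∣+∣q─p∣ C₁ (N G w) ⟩
      ∣ C₁ ∣ + ∣ N G w ─ C₁ ∣ ≡⟨ cong₂ _+_ (x∉p⇒∣p∪⁅x⁆∣≡1+∣p∣ w∉C) ∣N─C₁∣≡k+2 ⟩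
      suc ∣ C ∣ + (k + 2)     ≡⟨ +-suc ∣ C ∣ (k + 2) ⟨
      ∣ C ∣ + suc (k + 2)     ≡⟨ cong (∣ C ∣ +_) (+-suc k 2) ⟨
      ∣ C ∣ + (k + 3)         ∎)
      where open ≡-Reasoning

  complete-or-extend : (c : Certificate) → C c ≡ ⊤ ⊎ Extension c
  complete-or-extend c with any? (λ w → ¬? (w ∈? C c))
  ... | no none-outside =
    inj₁ (⊆-antisym ⊆⊤ λ {x} _ → decidable-stable (x ∈? C c) (λ x∉C → none-outside (x , x∉C)))
  ... | yes (w , w∉C) with any? (λ u → (u ∈? C c) ×-dec nonempty? (N G u ─ C c))
  ...   | yes (u , u∈C , boundary) = inj₂ (extend-at-boundary c u∈C boundary)
  ...   | no no-boundary = inj₂ (extend-outside-closed c w∉C closed)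
    where
    closed : ∀ {u x} → u ∈ C c → x ∈ N G u → x ∈ C c
    closed {u} {x} u∈C x∈N = decidable-stable (x ∈? C c)
      (λ x∉C → no-boundary (u , u∈C , x , x∈p∧x∉q⇒x∈p─q x∈N x∉C))

  saturate : ∀ fuel (c : Certificate) → n ≤ fuel + ∣ C c ∣ → ∃[ c′ ] C c′ ≡ ⊤
  saturate zero c n≤∣C∣ = c , ∣p∣≡n⇒p≡⊤ (≤-antisym (∣p∣≤n (C c)) n≤∣C∣)
  saturate (suc fuel) c n≤ with complete-or-extend c
  ... | inj₁ C≡⊤ = c , C≡⊤
  ... | inj₂ (c′ , ∣C∣<∣C′∣) = saturate fuel c′
    (≤-trans n≤ (≤-trans (≤-reflexive (≡-sym (+-suc fuel ∣ C c ∣))) (+-monoʳ-≤ fuel ∣C∣<∣C′∣)))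

  empty : Certificate
  empty = certificate ⊥ ⊥ Forces-⊥ (subst (λ s → s * (k + 3) ≤ 3 * s) (≡-sym (∣⊥∣≡0 n)) z≤n)

corollary5p8 : (k n : ℕ) (G : Graph n) →
    Connected G → Regular (k + 2) G → ¬ Iso G (Kbip (k + 2) (k + 2)) →
    Σ (Subset n) λ T → IsForcingSet G k T × ∣ T ∣ * (k + 3) ≤ 3 * n
corollary5p8 k n G _ regular _ =
  T c , Forces-⊤ (subst (Forces _ (T c)) C≡⊤ (forces c)) , T-small
  where
  open Forcing G k
  open Greedy G k regular
  open Certificate
  saturated : ∃[ c ] C c ≡ ⊤
  saturated = saturate n empty (m≤m+n n _)
  c = proj₁ saturated
  C≡⊤ = proj₂ saturated
  T-small : ∣ T c ∣ * (k + 3) ≤ 3 * n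
  T-small = ≤-trans (budget c) (*-monoʳ-≤ 3 (∣p∣≤n (C c)))
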